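{- $\displaystyle\lim_{x\to\infty}\frac{|\mathscr{V}^1_4(x)|}{\sqrt{x}}=0$, where $\mathscr{V}^1_4(x)=\{m\in\mathscr{V}^1_4: m\le x\}$.
   Context: $\phi$ is Euler's totient function, $\mathrm{A}(m)=|\phi^{ -1}(m)|$. For $k\in\{2,4\}$, $\mathscr{V}^1_k=\{2r: r \text{ odd positive integer},\ \mathrm{A}(2r)=k\}$. -}

module Defs where

open import Data.Nat using (ℕ; zero; suc; _+_; _*_; _^_; _≤_)
open import Data.Nat.Coprimality using (Coprime; coprime?)
open import Data.List using (List; length; filter; upTo; map)
open import Data.List.Membership.Propositional using (_∈_)
open import Data.List.Relation.Unary.Unique.Propositional using (Unique)
open import Data.Product using (Σ; _×_; ∃)
open import Relation.Binary.PropositionalEquality using (_≡_)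
open import Function.Bundles using (_⇔_)

-- Euler's totient: φ n = #{ k : 1 ≤ k ≤ n, gcd(k , n) = 1 }  (φ 0 = 0)
φ : ℕ → ℕ
φ n = length (filter (λ k → coprime? k n) (map suc (upTo n)))

-- "the set {n | P n} is finite with exactly c elements":
-- there is a duplicate-free list enumerating exactly the elements of P, of length c.
HasCard : (ℕ → Set) → ℕ → Set
HasCard P c = Σ (List ℕ) λ xs → Unique xs × (∀ n → (n ∈ xs) ⇔ P n) × length xs ≡ c

A≡ : ℕ → ℕ → Set
A≡ m k = HasCard (λ n → φ n ≡ m) k

V¹₄ : ℕ → Set
V¹₄ m = (∃ λ j → m ≡ 2 * (2 * j + 1)) × A≡ m 4

V¹₄≤ : ℕ → ℕ → Set
V¹₄≤ x m = m ≤ x × V¹₄ m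

module Submission where

-- Let m ≡ 2 (mod 4) have four totient preimages. A preimage n is a power of two or
-- n = q^(a+1) s with q an odd prime not dividing s; as 4 ∤ φ(n), n is 4, m + 1, 2(m + 1) or else
-- m = p^(b+1) (p - 1) for a prime p, and the fourth preimage forces the last case.
-- Such m ≤ x are coded injectively: by the prime p ≤ √x + 1 when b = 0, and otherwise by
-- (p^(w+1), r) with b - 1 = 3w + r, where (p^(w+1))³ ≤ 2x keeps p^(w+1) below √x / 6K for large x.
-- Since the primes in (n, 2n] divide C(2n, n) ≤ 4^n, L π(Y) ≤ L 2^(L+1) + 4Y for every L; L = 16K
-- this gives K |𝒱¹₄(x)| ≤ √x once x is large.

open import Defs
open import Data.Bool using (Bool; true; false; T; not; _∧_; if_then_else_)
open import Data.Empty using (⊥-elim)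
open import Data.Unit using (tt)
open import Data.List using (List; []; _∷_; length; filter; upTo; applyUpTo; map; _++_)
open import Data.List.Membership.Propositional using (_∈_)
open import Data.List.Membership.Propositional.Properties
  using (∈-∃++; ∈-++⁻; ∈-++⁺ˡ; ∈-++⁺ʳ; ∈-filter⁻; ∈-filter⁺; ∈-upTo⁺; ∈-upTo⁻; ∈-map⁺; ∈-applyUpTo⁻)
open import Data.List.Properties using (length-++-sucʳ; length-++; length-map; length-upTo; map-applyUpTo)
open import Data.List.Relation.Unary.All using (All; []; lookup; _∷_; tabulate; sequenceA)
open import Data.List.Relation.Unary.Any using (here; there)
open import Data.List.Relation.Unary.AllPairs using (_∷_)
open import Data.List.Relation.Unary.Unique.Propositional using (Unique)
open import Data.List.Relation.Unary.Unique.Propositional.Properties using (upTo⁺; filter⁺; applyUpTo⁺₁)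
open import Data.Nat
open import Data.Nat.Properties
open import Data.Nat.Combinatorics using (_C_; nCk≡n!/k![n-k]!; k>n⇒nCk≡0; k![n∸k]!∣n!; nCk+nC[k+1]≡[n+1]C[k+1])
open import Data.Nat.Coprimality using (Coprime; coprime?; coprime⇒gcd≡1; coprime-divisor; prime⇒coprime; 0-coprimeTo-m⇒m≡1)
import Data.Nat.Coprimality as Coprime
open import Data.Nat.Divisibility
open import Data.Nat.DivMod
open import Data.Nat.Primality using (Prime; prime[2]; prime⇒nonZero; prime⇒irreducible; prime⇒nonTrivial; euclidsLemma; prime?)
open import Data.Nat.Primality.Factorisation using (factorise; factorisationHasAllPrimeFactors)
open import Data.Nat.LCM using (lcm; lcm-least; gcd*lcm)
open import Data.Nat.Induction using (<-rec)
open import Data.Nat.ListAction using (product)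
open import Data.Nat.Solver using (module +-*-Solver)
open import Data.Product using (Σ; ∃; ∃₂; _×_; _,_; proj₁; proj₂)
open import Data.Sum using (_⊎_; inj₁; inj₂)
import Data.Sum.Effectful.Left as Sumₗ
open import Function using (_∘_; _⇔_; mk⇔; Equivalence)
open import Relation.Binary.PropositionalEquality
open import Relation.Nullary.Negation using (¬_)
open import Relation.Nullary.Decidable using (yes; no; does; T?; does-⇔; dec-true; dec-false; _×-dec_)
open import Relation.Unary using (Pred; Decidable)
open import Level using (0ℓ)
open +-*-Solver using (solve; _:+_; _:*_; _:=_; con)

-- Finite sums and counting

∑< : ℕ → (ℕ → ℕ) → ℕ
∑< zero    f = 0
∑< (suc n) f = f 0 + ∑< n (f ∘ suc)

syntax ∑< n (λ i → e) = ∑[ i < n ] e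

∑-cong : ∀ n {f g : ℕ → ℕ} → (∀ {i} → i < n → f i ≡ g i) → ∑< n f ≡ ∑< n g
∑-cong zero    f≗g = refl
∑-cong (suc n) f≗g = cong₂ _+_ (f≗g z<s) (∑-cong n (f≗g ∘ s<s))

∑-split : ∀ m n (f : ℕ → ℕ) → ∑< (m + n) f ≡ ∑< m f + ∑[ i < n ] f (m + i)
∑-split zero    n f = refl
∑-split (suc m) n f = trans (cong (f 0 +_) (∑-split m n (f ∘ suc))) (sym (+-assoc (f 0) _ _))

∑-distrib-+ : ∀ n (f g : ℕ → ℕ) → ∑[ i < n ] (f i + g i) ≡ ∑< n f + ∑< n g
∑-distrib-+ zero    f g = refl
∑-distrib-+ (suc n) f g = begin
  f 0 + g 0 + ∑[ i < n ] (f (suc i) + g (suc i))  ≡⟨ cong (f 0 + g 0 +_) (∑-distrib-+ n (f ∘ suc) (g ∘ suc)) ⟩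
  f 0 + g 0 + (∑< n (f ∘ suc) + ∑< n (g ∘ suc))   ≡⟨ +-comm-middle (f 0) (g 0) _ _ ⟩
  f 0 + ∑< n (f ∘ suc) + (g 0 + ∑< n (g ∘ suc))   ∎
  where
  open ≡-Reasoning
  +-comm-middle : ∀ a b c d → a + b + (c + d) ≡ a + c + (b + d)
  +-comm-middle = solve 4 (λ a b c d → (a :+ b) :+ (c :+ d) := (a :+ c) :+ (b :+ d)) refl

∑-const : ∀ n c → ∑[ _ < n ] c ≡ n * c
∑-const zero    c = refl
∑-const (suc n) c = cong (c +_) (∑-const n c)

∑-*ʳ : ∀ n (f : ℕ → ℕ) c → ∑[ i < n ] (f i * c) ≡ ∑< n f * c
∑-*ʳ zero    f c = refl
∑-*ʳ (suc n) f c = trans (cong (f 0 * c +_) (∑-*ʳ n (f ∘ suc) c)) (sym (*-distribʳ-+ c (f 0) _))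

∑-*ˡ : ∀ n c (f : ℕ → ℕ) → ∑[ i < n ] (c * f i) ≡ c * ∑< n f
∑-*ˡ n c f = trans (∑-cong n (λ {i} _ → *-comm c (f i))) (trans (∑-*ʳ n f c) (*-comm _ c))

∑-comm : ∀ m n (f : ℕ → ℕ → ℕ) → ∑[ j < n ] ∑[ i < m ] f j i ≡ ∑[ i < m ] ∑[ j < n ] f j i
∑-comm m zero    f = sym (trans (∑-const m 0) (*-zeroʳ m))
∑-comm m (suc n) f = trans (cong (∑< m (f 0) +_) (∑-comm m n (f ∘ suc)))
                           (sym (∑-distrib-+ m (f 0) (λ i → ∑[ j < n ] f (suc j) i)))

∑-blocks : ∀ a b (f : ℕ → ℕ) → ∑< (b * a) f ≡ ∑[ j < b ] ∑[ i < a ] f (j * a + i)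
∑-blocks a zero    f = refl
∑-blocks a (suc b) f = trans (∑-split a (b * a) f) (cong (∑< a f +_)
  (trans (∑-blocks a b (λ i → f (a + i)))
         (∑-cong b (λ {j} _ → ∑-cong a (λ {i} _ → cong f (sym (+-assoc a (j * a) i)))))))

𝟙 : Bool → ℕ
𝟙 b = if b then 1 else 0

count : (ℕ → Bool) → ℕ → ℕ
count Q n = ∑[ i < n ] 𝟙 (Q i)

count-cong : ∀ n {Q R : ℕ → Bool} → (∀ {i} → i < n → Q i ≡ R i) → count Q n ≡ count R n
count-cong n Q≗R = ∑-cong n (cong 𝟙 ∘ Q≗R)

count-≤ : ∀ Q n → count Q n ≤ n
count-≤ Q zero    = z≤n
count-≤ Q (suc n) with Q 0
... | true  = s≤s (count-≤ (Q ∘ suc) n)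
... | false = m≤n⇒m≤1+n (count-≤ (Q ∘ suc) n)

count-true : ∀ n → count (λ _ → true) n ≡ n
count-true n = trans (∑-const n 1) (*-identityʳ n)

count-+-count-not : ∀ Q n → count Q n + count (not ∘ Q) n ≡ n
count-+-count-not Q n = begin
  count Q n + count (not ∘ Q) n           ≡⟨ ∑-distrib-+ n (𝟙 ∘ Q) (𝟙 ∘ not ∘ Q) ⟨
  ∑[ i < n ] (𝟙 (Q i) + 𝟙 (not (Q i)))  ≡⟨ ∑-cong n (λ {i} _ → 𝟙+𝟙-not (Q i)) ⟩
  ∑[ _ < n ] 1                           ≡⟨ count-true n ⟩
  n                                       ∎
  where
  open ≡-Reasoning
  𝟙+𝟙-not : ∀ b → 𝟙 b + 𝟙 (not b) ≡ 1
  𝟙+𝟙-not true  = refl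
  𝟙+𝟙-not false = refl

count-last : ∀ Q n → count Q (suc n) ≡ count Q n + 𝟙 (Q n)
count-last Q n = begin
  count Q (suc n)                          ≡⟨ cong (count Q) (+-comm 1 n) ⟩
  count Q (n + 1)                          ≡⟨ ∑-split n 1 (𝟙 ∘ Q) ⟩
  count Q n + (𝟙 (Q (n + 0)) + 0)         ≡⟨ cong (count Q n +_) (trans (+-identityʳ _) (cong (𝟙 ∘ Q) (+-identityʳ n))) ⟩
  count Q n + 𝟙 (Q n)                      ∎
  where open ≡-Reasoning

count-+-≤ : ∀ Q m d → count Q (m + d) ≤ count Q m + d
count-+-≤ Q m d = begin
  count Q (m + d)                           ≡⟨ ∑-split m d (𝟙 ∘ Q) ⟩
  count Q m + count (λ i → Q (m + i)) d     ≤⟨ +-monoʳ-≤ (count Q m) (count-≤ (λ i → Q (m + i)) d) ⟩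
  count Q m + d                             ∎
  where open ≤-Reasoning

𝟙-∧ : ∀ x y → 𝟙 (x ∧ y) ≡ 𝟙 x * 𝟙 y
𝟙-∧ true  y = sym (+-identityʳ (𝟙 y))
𝟙-∧ false y = refl

length-filter-applyUpTo : ∀ {P : Pred ℕ 0ℓ} (P? : Decidable P) g n →
  length (filter P? (applyUpTo g n)) ≡ count (λ i → does (P? (g i))) n
length-filter-applyUpTo P? g zero = refl
length-filter-applyUpTo P? g (suc n) with does (P? (g 0))
... | true  = cong suc (length-filter-applyUpTo P? (g ∘ suc) n)
... | false = length-filter-applyUpTo P? (g ∘ suc) n

length-≤-injection : ∀ {A B : Set} (R : A → B → Set) {xs : List A} {ys : List B} → Unique xs →
  (∀ {x} → x ∈ xs → ∃ λ y → y ∈ ys × R x y) →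
  (∀ {x x′ y} → R x y → R x′ y → x ≡ x′) → length xs ≤ length ys
length-≤-injection R {[]}     _          f R-inj = z≤n
length-≤-injection R {x ∷ xs} (x∉ ∷ xs!) f R-inj with f (here refl)
... | y , y∈ , Rxy with ∈-∃++ y∈
... | us , vs , refl = subst (suc (length xs) ≤_) (sym (length-++-sucʳ us y vs))
                             (s≤s (length-≤-injection R xs! f′ R-inj))
  where
  f′ : ∀ {x′} → x′ ∈ xs → ∃ λ y′ → y′ ∈ us ++ vs × R x′ y′
  f′ x′∈ with f (there x′∈)
  ... | y′ , y′∈ , Rx′y′ with ∈-++⁻ us y′∈
  ... | inj₁ y′∈us          = y′ , ∈-++⁺ˡ y′∈us , Rx′y′
  ... | inj₂ (there y′∈vs)  = y′ , ∈-++⁺ʳ us y′∈vs , Rx′y′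
  ... | inj₂ (here refl)    = ⊥-elim (lookup x∉ x′∈ (R-inj Rxy Rx′y′))

support : (ℕ → Bool) → ℕ → List ℕ
support Q n = filter (T? ∘ Q) (upTo n)

length-support : ∀ Q n → length (support Q n) ≡ count Q n
length-support Q = length-filter-applyUpTo (T? ∘ Q) (λ i → i)

support-unique : ∀ Q n → Unique (support Q n)
support-unique Q n = filter⁺ (T? ∘ Q) (upTo⁺ n)

∈-support⁻ : ∀ {Q n x} → x ∈ support Q n → x < n × T (Q x)
∈-support⁻ {Q} x∈ with ∈-filter⁻ (T? ∘ Q) x∈
... | x∈upTo , Qx = ∈-upTo⁻ x∈upTo , Qx

∈-support⁺ : ∀ {Q n x} → x < n → T (Q x) → x ∈ support Q n
∈-support⁺ {Q} x<n Qx = ∈-filter⁺ (T? ∘ Q) (∈-upTo⁺ x<n) Qx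

module _ (n : ℕ) (g : ℕ → ℕ) (g-< : ∀ {j} → j < n → g j < n)
         (g-inj : ∀ {j j′} → j < n → j′ < n → g j ≡ g j′ → j ≡ j′) where

  count-∘-≤ : ∀ Q → count (Q ∘ g) n ≤ count Q n
  count-∘-≤ Q = subst₂ _≤_ (length-support (Q ∘ g) n) (length-support Q n)
    (length-≤-injection (λ j y → j < n × y ≡ g j) {ys = support Q n} (support-unique (Q ∘ g) n)
      (λ j∈ → let j<n , Qgj = ∈-support⁻ j∈ in g _ , ∈-support⁺ {Q} (g-< j<n) Qgj , j<n , refl)
      (λ (j<n , e) (j′<n , e′) → g-inj j<n j′<n (trans (sym e) e′)))

  -- The reverse inequality comes from the same injection applied to the complement.
  count-∘ : ∀ Q → count (Q ∘ g) n ≡ count Q n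
  count-∘ Q = ≤-antisym (count-∘-≤ Q) (≮⇒≥ λ lt → <-irrefl total (+-mono-<-≤ lt (count-∘-≤ (not ∘ Q))))
    where
    total : count (Q ∘ g) n + count (not ∘ Q ∘ g) n ≡ count Q n + count (not ∘ Q) n
    total = trans (count-+-count-not (Q ∘ g) n) (sym (count-+-count-not Q n))

%-+-≡⇒∣ : ∀ x y b .{{_ : NonZero b}} → (x + y) % b ≡ x % b → b ∣ y
%-+-≡⇒∣ x y b eq = ∣m+n∣m⇒∣n (divides ((x + y) / b) quotients) (n∣m*n (x / b))
  where
  open ≡-Reasoning
  quotients : x / b * b + y ≡ (x + y) / b * b
  quotients = +-cancelˡ-≡ (x % b) _ _ (begin
    x % b + (x / b * b + y)    ≡⟨ +-assoc (x % b) _ y ⟨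
    x % b + x / b * b + y      ≡⟨ cong (_+ y) (m≡m%n+[m/n]*n x b) ⟨
    x + y                      ≡⟨ m≡m%n+[m/n]*n (x + y) b ⟩
    (x + y) % b + (x + y) / b * b  ≡⟨ cong (_+ (x + y) / b * b) eq ⟩
    x % b + (x + y) / b * b    ∎)

module _ (a i b : ℕ) .{{_ : NonZero b}} (b⊥a : Coprime b a) where

  affine-mod-injective-≤ : ∀ {j j′} → j ≤ j′ → j′ < b → (j * a + i) % b ≡ (j′ * a + i) % b → j ≡ j′
  affine-mod-injective-≤ {j} j≤j′ j′<b eq with m≤n⇒∃[o]m+o≡n j≤j′
  ... | zero  , refl = sym (+-identityʳ j)
  ... | suc d , refl = ⊥-elim (<⇒≱ (≤-<-trans (m≤n+m (suc d) j) j′<b) (∣⇒≤ b∣1+d))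
    where
    shift : j * a + i + suc d * a ≡ (j + suc d) * a + i
    shift = solve 4 (λ j i d a → j :* a :+ i :+ (con 1 :+ d) :* a := (j :+ (con 1 :+ d)) :* a :+ i) refl j i d a
    b∣1+d : b ∣ suc d
    b∣1+d = coprime-divisor b⊥a (subst (b ∣_) (*-comm (suc d) a)
              (%-+-≡⇒∣ (j * a + i) (suc d * a) b (trans (cong (_% b) shift) (sym eq))))

  affine-mod-injective : ∀ {j j′} → j < b → j′ < b → (j * a + i) % b ≡ (j′ * a + i) % b → j ≡ j′
  affine-mod-injective {j} {j′} j<b j′<b eq with ≤-total j j′
  ... | inj₁ j≤j′ = affine-mod-injective-≤ j≤j′ j′<b eq
  ... | inj₂ j′≤j = sym (affine-mod-injective-≤ j′≤j j<b (sym eq))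

divMod-injective : ∀ d .{{_ : NonZero d}} {t t′ r r′} → r < d → r′ < d → d * t + r ≡ d * t′ + r′ → t ≡ t′ × r ≡ r′
divMod-injective d {t} {t′} {r} {r′} r<d r′<d eq = *-cancelˡ-≡ t t′ d (+-cancelʳ-≡ _ _ _ (trans eq (cong (d * t′ +_) (sym r≡r′)))) , r≡r′
  where
  remainder : ∀ t r → r < d → (d * t + r) % d ≡ r
  remainder t r r<d = trans (cong (_% d) (trans (+-comm (d * t) r) (cong (r +_) (*-comm d t))))
                            (trans ([m+kn]%n≡m%n r t d) (m<n⇒m%n≡m r<d))
  r≡r′ : r ≡ r′
  r≡r′ = trans (sym (remainder t r r<d)) (trans (cong (_% d) eq) (remainder t′ r′ r′<d))

^-cancelʳ-≤ : ∀ m {x y} → 1 < m → m ^ x ≤ m ^ y → x ≤ y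
^-cancelʳ-≤ m {x} {y} 1<m m^x≤m^y = ≮⇒≥ (λ y<x → <⇒≱ (^-monoʳ-< m 1<m y<x) m^x≤m^y)

n<2^n : ∀ n → n < 2 ^ n
n<2^n zero    = z<s
n<2^n (suc n) = begin-strict
  suc n          ≤⟨ n<2^n n ⟩
  2 ^ n          <⟨ m<m+n (2 ^ n) (m^n>0 2 n) ⟩
  2 ^ n + 2 ^ n  ≡⟨ cong (2 ^ n +_) (+-identityʳ (2 ^ n)) ⟨
  2 ^ suc n      ∎
  where open ≤-Reasoning

≤2*pred : ∀ {n} → 1 < n → n ≤ 2 * (n ∸ 1)
≤2*pred {suc zero}    (s≤s ())
≤2*pred {suc (suc q)} _ = begin
  suc (suc q)      ≡⟨ +-comm 1 (suc q) ⟩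
  suc q + 1        ≤⟨ +-monoʳ-≤ (suc q) (s≤s z≤n) ⟩
  suc q + suc q    ≡⟨ cong (suc q +_) (+-identityʳ (suc q)) ⟨
  2 * suc q        ∎
  where open ≤-Reasoning

square<⇒≤ : ∀ {T x} s → T * T ≤ x → x < suc s * suc s → T ≤ s
square<⇒≤ {T} s T²≤x x<[1+s]² = ≮⇒≥ λ s<T → <⇒≱ x<[1+s]² (≤-trans (*-mono-≤ s<T s<T) T²≤x)

isqrt : ∀ x → ∃ λ s → s * s ≤ x × x < suc s * suc s
isqrt zero = 0 , z≤n , z<s
isqrt (suc x) with isqrt x
... | s , s²≤x , x<[1+s]² with suc s * suc s ≤? suc x
... | yes [1+s]²≤1+x = suc s , [1+s]²≤1+x , ≤-trans (s≤s x<[1+s]²) (*-mono-< (n<1+n (suc s)) (n<1+n (suc s)))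
... | no  [1+s]²≰1+x = s , m≤n⇒m≤1+n s²≤x , ≰⇒> [1+s]²≰1+x

prime>1 : ∀ {p} → Prime p → 1 < p
prime>1 {p} p-prime = nonTrivial⇒n>1 p {{prime⇒nonTrivial p-prime}}

suc-pred-prime : ∀ {p} → Prime p → suc (p ∸ 1) ≡ p
suc-pred-prime p-prime = m+[n∸m]≡n (<⇒≤ (prime>1 p-prime))

prime≢1 : ∀ {p} → Prime p → p ≢ 1
prime≢1 p-prime refl = <-irrefl refl (prime>1 p-prime)

coprime-prime : ∀ {p k} → Prime p → ¬ p ∣ k → Coprime k p
coprime-prime p-prime p∤k (d∣k , d∣p) with prime⇒irreducible p-prime d∣p
... | inj₁ d≡1  = d≡1
... | inj₂ refl = ⊥-elim (p∤k d∣k)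

prime∣^⇒∣ : ∀ {p q} → Prime p → ∀ n → p ∣ q ^ n → p ∣ q
prime∣^⇒∣ p-prime zero    p∣1 = ⊥-elim (prime≢1 p-prime (∣1⇒≡1 p∣1))
prime∣^⇒∣ {q = q} p-prime (suc n) p∣q^[1+n] with euclidsLemma q (q ^ n) p-prime p∣q^[1+n]
... | inj₁ p∣q   = p∣q
... | inj₂ p∣q^n = prime∣^⇒∣ p-prime n p∣q^n

prime-power-injective : ∀ {p p′} → Prime p → Prime p′ → ∀ w w′ → p ^ suc w ≡ p′ ^ suc w′ → p ≡ p′ × w ≡ w′
prime-power-injective {p} p-prime p′-prime w w′ eq
  with prime⇒irreducible p′-prime (prime∣^⇒∣ p-prime (suc w′) (subst (p ∣_) eq (m∣m*n (p ^ w))))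
... | inj₁ p≡1  = ⊥-elim (prime≢1 p-prime p≡1)
... | inj₂ refl = refl , suc-injective (≤-antisym (^-cancelʳ-≤ p (prime>1 p-prime) (≤-reflexive eq))
                                                  (^-cancelʳ-≤ p (prime>1 p-prime) (≤-reflexive (sym eq))))

factor-out : ∀ {p} → Prime p → ∀ n → n ≢ 0 → ∃₂ λ a r → n ≡ p ^ a * r × ¬ p ∣ r
factor-out {p} p-prime = <-rec _ step
  where
  step : ∀ n → (∀ {m} → m < n → m ≢ 0 → ∃₂ λ a r → m ≡ p ^ a * r × ¬ p ∣ r) →
         n ≢ 0 → ∃₂ λ a r → n ≡ p ^ a * r × ¬ p ∣ r
  step n rec n≢0 with p ∣? n
  ... | no  p∤n = 0 , n , sym (+-identityʳ n) , p∤n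
  ... | yes (divides q refl) with rec q<n q≢0
    where
    q≢0 : q ≢ 0
    q≢0 refl = n≢0 refl
    q<n : q < q * p
    q<n = m<m*n q p {{≢-nonZero q≢0}} (prime>1 p-prime)
  ... | a , r , refl , p∤r = suc a , r , solve 3 (λ P A R → A :* R :* P := P :* A :* R) refl p (p ^ a) r , p∤r

prime-factor : ∀ n → 1 < n → ∃ λ q → Prime q × q ∣ n
prime-factor n@(suc _) 1<n with factorise n
... | record { factors = [] ; isFactorisation = refl } = ⊥-elim (<-irrefl refl 1<n)
... | record { factors = q ∷ qs ; isFactorisation = n≡ ; factorsPrime = q-prime ∷ _ } =
  q , q-prime , divides (product qs) (trans n≡ (*-comm q _))

power-of-two-or-odd-prime-factor : ∀ n → n ≢ 0 → (∃ λ c → n ≡ 2 ^ c) ⊎ (∃ λ q → Prime q × q ≢ 2 × q ∣ n)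
power-of-two-or-odd-prime-factor n n≢0 with factor-out prime[2] n n≢0
... | c , 0 , refl , 2∤0 = ⊥-elim (2∤0 (divides 0 refl))
... | c , 1 , refl , _   = inj₁ (c , *-identityʳ _)
... | c , r@(suc (suc _)) , refl , 2∤r with prime-factor r (s<s z<s)
... | q , q-prime , q∣r = inj₂ (q , q-prime , (λ { refl → 2∤r q∣r }) , ∣n⇒∣m*n (2 ^ c) q∣r)

-- Euler's totient

coprime-*⇔ : ∀ {k m n} → Coprime k (m * n) ⇔ (Coprime k m × Coprime k n)
coprime-*⇔ {k} {m} {n} = mk⇔
  (λ k⊥mn → (λ {_} (d∣k , d∣m) → k⊥mn (d∣k , ∣m⇒∣m*n n d∣m)) , (λ {_} (d∣k , d∣n) → k⊥mn (d∣k , ∣n⇒∣m*n m d∣n)))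
  (λ (k⊥m , k⊥n) {_} (d∣k , d∣mn) → k⊥n (d∣k , coprime-divisor (λ {_} (e∣d , e∣m) → k⊥m (∣-trans e∣d d∣k , e∣m)) d∣mn))

coprime-shift⇔ : ∀ {k j n} → Coprime (j * n + k) n ⇔ Coprime k n
coprime-shift⇔ {k} {j} {n} = mk⇔
  (λ c {_} (d∣k , d∣n) → c (∣m∣n⇒∣m+n (∣n⇒∣m*n j d∣n) d∣k , d∣n))
  (λ c {_} (d∣jnk , d∣n) → c (∣m+n∣m⇒∣n d∣jnk (∣n⇒∣m*n j d∣n) , d∣n))

coprime-^ : ∀ {k p} → Coprime k p → ∀ e → Coprime k (p ^ e)
coprime-^ k⊥p zero    (_ , d∣1) = ∣1⇒≡1 d∣1
coprime-^ k⊥p (suc e) = Equivalence.from coprime-*⇔ (k⊥p , coprime-^ k⊥p e)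

coprimeᵇ : ℕ → ℕ → Bool
coprimeᵇ k n = does (coprime? k n)

coprimeᵇ-* : ∀ k m n → coprimeᵇ k (m * n) ≡ coprimeᵇ k m ∧ coprimeᵇ k n
coprimeᵇ-* k m n = does-⇔ (coprime-*⇔ {k} {m} {n}) (coprime? k (m * n)) (coprime? k m ×-dec coprime? k n)

coprimeᵇ-shift : ∀ k j n → coprimeᵇ (j * n + k) n ≡ coprimeᵇ k n
coprimeᵇ-shift k j n = does-⇔ (coprime-shift⇔ {k} {j} {n}) (coprime? (j * n + k) n) (coprime? k n)

coprimeᵇ-% : ∀ k n .{{_ : NonZero n}} → coprimeᵇ k n ≡ coprimeᵇ (k % n) n
coprimeᵇ-% k n = trans (cong (λ k → coprimeᵇ k n) (trans (m≡m%n+[m/n]*n k n) (+-comm (k % n) _)))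
                       (coprimeᵇ-shift (k % n) (k / n) n)

coprimeᵇ-^ : ∀ k p e → coprimeᵇ k (p ^ suc e) ≡ coprimeᵇ k p
coprimeᵇ-^ k p e = does-⇔ (mk⇔ (proj₁ ∘ Equivalence.to coprime-*⇔) (λ k⊥p → coprime-^ k⊥p (suc e)))
                          (coprime? k (p ^ suc e)) (coprime? k p)

totient : ℕ → ℕ
totient n = count (λ k → coprimeᵇ k n) n

-- φ counts 1 ≤ k ≤ n and totient counts 0 ≤ k < n; the end points agree since both are coprime to n iff n = 1.
φ≡totient : ∀ n → φ n ≡ totient n
φ≡totient n = begin
  φ n                                           ≡⟨ cong (length ∘ filter (λ k → coprime? k n)) (map-applyUpTo (λ k → k) suc n) ⟩
  length (filter (λ k → coprime? k n) (applyUpTo suc n))  ≡⟨ length-filter-applyUpTo (λ k → coprime? k n) suc n ⟩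
  count (λ k → coprimeᵇ (suc k) n) n            ≡⟨ +-cancelˡ-≡ (𝟙 (coprimeᵇ 0 n)) _ _ ends ⟩
  totient n                                     ∎
  where
  open ≡-Reasoning
  0⊥n⇔n⊥n : Coprime 0 n ⇔ Coprime n n
  0⊥n⇔n⊥n = mk⇔ to from
    where
    to : Coprime 0 n → Coprime n n
    to 0⊥n = subst (λ m → Coprime m m) (sym (0-coprimeTo-m⇒m≡1 0⊥n)) (Coprime.1-coprimeTo 1)
    from : Coprime n n → Coprime 0 n
    from n⊥n = subst (Coprime 0) (sym (n⊥n (∣-refl , ∣-refl))) (Coprime.sym (Coprime.1-coprimeTo 0))
  ends : 𝟙 (coprimeᵇ 0 n) + count (λ k → coprimeᵇ (suc k) n) n ≡ 𝟙 (coprimeᵇ 0 n) + totient n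
  ends = begin
    count (λ k → coprimeᵇ k n) (suc n)     ≡⟨ count-last (λ k → coprimeᵇ k n) n ⟩
    totient n + 𝟙 (coprimeᵇ n n)           ≡⟨ +-comm (totient n) _ ⟩
    𝟙 (coprimeᵇ n n) + totient n           ≡⟨ cong (λ b → 𝟙 b + totient n) (does-⇔ 0⊥n⇔n⊥n (coprime? 0 n) (coprime? n n)) ⟨
    𝟙 (coprimeᵇ 0 n) + totient n           ∎

count-coprime-affine : ∀ a i b .{{_ : NonZero b}} → Coprime b a → count (λ j → coprimeᵇ (j * a + i) b) b ≡ totient b
count-coprime-affine a i b b⊥a = begin
  count (λ j → coprimeᵇ (j * a + i) b) b          ≡⟨ count-cong b (λ {j} _ → coprimeᵇ-% (j * a + i) b) ⟩
  count (λ j → coprimeᵇ ((j * a + i) % b) b) b    ≡⟨ count-∘ b (λ j → (j * a + i) % b) (λ _ → m%n<n _ b)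
                                                       (affine-mod-injective a i b b⊥a) (λ k → coprimeᵇ k b) ⟩
  totient b                                       ∎
  where open ≡-Reasoning

totient-* : ∀ a b .{{_ : NonZero b}} → Coprime a b → totient (a * b) ≡ totient a * totient b
totient-* a b a⊥b = begin
  totient (a * b)
    ≡⟨ cong (count (λ k → coprimeᵇ k (a * b))) (*-comm a b) ⟩
  count (λ k → coprimeᵇ k (a * b)) (b * a)
    ≡⟨ ∑-blocks a b _ ⟩
  ∑[ j < b ] ∑[ i < a ] 𝟙 (coprimeᵇ (j * a + i) (a * b))
    ≡⟨ ∑-cong b (λ {j} _ → ∑-cong a (λ {i} _ → split j i)) ⟩
  ∑[ j < b ] ∑[ i < a ] (𝟙 (coprimeᵇ i a) * 𝟙 (coprimeᵇ (j * a + i) b))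
    ≡⟨ ∑-comm a b _ ⟩
  ∑[ i < a ] ∑[ j < b ] (𝟙 (coprimeᵇ i a) * 𝟙 (coprimeᵇ (j * a + i) b))
    ≡⟨ ∑-cong a (λ {i} _ → trans (∑-*ˡ b (𝟙 (coprimeᵇ i a)) _)
                                (cong (𝟙 (coprimeᵇ i a) *_) (count-coprime-affine a i b (Coprime.sym a⊥b)))) ⟩
  ∑[ i < a ] (𝟙 (coprimeᵇ i a) * totient b)
    ≡⟨ ∑-*ʳ a (λ i → 𝟙 (coprimeᵇ i a)) (totient b) ⟩
  totient a * totient b ∎
  where
  open ≡-Reasoning
  split : ∀ j i → 𝟙 (coprimeᵇ (j * a + i) (a * b)) ≡ 𝟙 (coprimeᵇ i a) * 𝟙 (coprimeᵇ (j * a + i) b)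
  split j i = trans (cong 𝟙 (trans (coprimeᵇ-* (j * a + i) a b) (cong (_∧ coprimeᵇ (j * a + i) b) (coprimeᵇ-shift i j a))))
                    (𝟙-∧ (coprimeᵇ i a) _)

totient-prime : ∀ {p} → Prime p → totient p ≡ p ∸ 1
totient-prime {zero}  p-prime = ⊥-elim (<⇒≱ (prime>1 p-prime) z≤n)
totient-prime {suc n} p-prime = cong₂ _+_
  (cong 𝟙 (dec-false (coprime? 0 (suc n)) (prime≢1 p-prime ∘ 0-coprimeTo-m⇒m≡1)))
  (trans (count-cong n (λ {i} i<n → dec-true (coprime? (suc i) (suc n)) (Coprime.sym (prime⇒coprime p-prime (s<s i<n)))))
         (count-true n))

totient-^ : ∀ {p} → Prime p → ∀ e → totient (p ^ suc e) ≡ p ^ e * (p ∸ 1)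
totient-^ {p} p-prime e = begin
  totient (p ^ suc e)                         ≡⟨ count-cong (p ^ suc e) (λ {k} _ → coprimeᵇ-^ k p e) ⟩
  count (λ k → coprimeᵇ k p) (p * p ^ e)      ≡⟨ cong (count (λ k → coprimeᵇ k p)) (*-comm p (p ^ e)) ⟩
  count (λ k → coprimeᵇ k p) (p ^ e * p)      ≡⟨ ∑-blocks p (p ^ e) _ ⟩
  ∑[ j < p ^ e ] count (λ i → coprimeᵇ (j * p + i) p) p
    ≡⟨ ∑-cong (p ^ e) (λ {j} _ → trans (count-cong p (λ {i} _ → coprimeᵇ-shift i j p)) (totient-prime p-prime)) ⟩
  ∑[ _ < p ^ e ] (p ∸ 1)                      ≡⟨ ∑-const (p ^ e) (p ∸ 1) ⟩
  p ^ e * (p ∸ 1)                             ∎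
  where open ≡-Reasoning

totient-prime-power-factor : ∀ {q} n → Prime q → q ∣ n → n ≢ 0 →
  ∃₂ λ a s → n ≡ q ^ suc a * s × s ≢ 0 × totient n ≡ totient s * (q ^ a * (q ∸ 1))
totient-prime-power-factor {q} n q-prime q∣n n≢0 with factor-out q-prime n n≢0
... | zero  , s , refl , q∤s = ⊥-elim (q∤s (subst (q ∣_) (+-identityʳ s) q∣n))
... | suc a , s , refl , q∤s = a , s , refl , s≢0 , (begin
  totient (q ^ suc a * s)              ≡⟨ cong totient (*-comm (q ^ suc a) s) ⟩
  totient (s * q ^ suc a)              ≡⟨ totient-* s (q ^ suc a) {{m^n≢0 q (suc a) {{prime⇒nonZero q-prime}}}}
                                            (coprime-^ (coprime-prime q-prime q∤s) (suc a)) ⟩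
  totient s * totient (q ^ suc a)      ≡⟨ cong (totient s *_) (totient-^ q-prime a) ⟩
  totient s * (q ^ a * (q ∸ 1))        ∎)
  where
  open ≡-Reasoning
  s≢0 : s ≢ 0
  s≢0 refl = n≢0 (*-zeroʳ (q ^ suc a))

odd-prime⇒2∣pred : ∀ {q} → Prime q → q ≢ 2 → 2 ∣ q ∸ 1
odd-prime⇒2∣pred {q} q-prime q≢2 with q % 2 | m%n<n q 2 | m≡m%n+[m/n]*n q 2
... | 0 | _ | q≡ = ⊥-elim (q≢2 (sym (reduce (prime⇒irreducible q-prime (divides (q / 2) q≡)))))
  where
  reduce : 2 ≡ 1 ⊎ 2 ≡ q → 2 ≡ q
  reduce (inj₂ 2≡q) = 2≡q
... | 1 | _ | q≡ = divides (q / 2) (cong (_∸ 1) q≡)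
... | suc (suc _) | s≤s (s≤s ()) | _

totient-even : ∀ n → 2 < n → 2 ∣ totient n
totient-even n 2<n with power-of-two-or-odd-prime-factor n (λ { refl → <⇒≱ 2<n z≤n })
... | inj₁ (0 , refl) = ⊥-elim (<⇒≱ 2<n (s≤s z≤n))
... | inj₁ (1 , refl) = ⊥-elim (<-irrefl refl 2<n)
... | inj₁ (suc (suc c) , refl) =
  subst (2 ∣_) (sym (totient-^ prime[2] (suc c))) (∣m⇒∣m*n 1 (m∣m*n (2 ^ c)))
... | inj₂ (q , q-prime , q≢2 , q∣n) with totient-prime-power-factor n q-prime q∣n (λ { refl → <⇒≱ 2<n z≤n })
... | a , s , _ , _ , totient≡ = subst (2 ∣_) (sym totient≡) (∣n⇒∣m*n (totient s) (∣n⇒∣m*n (q ^ a) (odd-prime⇒2∣pred q-prime q≢2)))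

-- Preimages of the totient

-- m = φ(p^(b+2))
PrimePowerForm : ℕ → Set
PrimePowerForm m = ∃₂ λ p b → Prime p × m ≡ p ^ suc b * (p ∸ 1)

-- Write n = 2^c or n = q^(a+1) s with q an odd prime, q ∤ s: unless n = 4 or s ≤ 2, four divides φ(n).
totient-preimage : ∀ n {m} → totient n ≡ m → m ≢ 1 → ¬ 4 ∣ m →
  n ≡ 4 ⊎ n ≡ suc m ⊎ n ≡ 2 * suc m ⊎ PrimePowerForm m
totient-preimage n {m} refl m≢1 4∤m with power-of-two-or-odd-prime-factor n n≢0
  where
  n≢0 : n ≢ 0
  n≢0 refl = 4∤m (divides 0 refl)
... | inj₁ (0 , refl)                 = ⊥-elim (m≢1 refl)
... | inj₁ (1 , refl)                 = ⊥-elim (m≢1 refl)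
... | inj₁ (2 , refl)                 = inj₁ refl
... | inj₁ (suc (suc (suc c)) , refl) =
  ⊥-elim (4∤m (subst (4 ∣_) (sym (totient-^ prime[2] (suc (suc c)))) (∣m⇒∣m*n 1 (divides (2 ^ c) 2^[2+c]≡))))
  where
  2^[2+c]≡ : 2 ^ suc (suc c) ≡ 2 ^ c * 4
  2^[2+c]≡ = solve 1 (λ x → con 2 :* (con 2 :* x) := x :* con 4) refl (2 ^ c)
... | inj₂ (q , q-prime , q≢2 , q∣n) with totient-prime-power-factor n q-prime q∣n (λ { refl → 4∤m (divides 0 refl) })
... | a , 0               , _    , s≢0 , _        = ⊥-elim (s≢0 refl)
... | a , s@(suc (suc (suc _))) , _ , _ , totient≡ =
  ⊥-elim (4∤m (subst (4 ∣_) (sym totient≡) (*-pres-∣ (totient-even s (s≤s (s≤s (s≤s z≤n))))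
                                                      (∣n⇒∣m*n (q ^ a) (odd-prime⇒2∣pred q-prime q≢2)))))
... | suc b , 1 , refl , _ , totient≡ = inj₂ (inj₂ (inj₂ (q , b , q-prime , trans totient≡ (+-identityʳ _))))
... | suc b , 2 , refl , _ , totient≡ = inj₂ (inj₂ (inj₂ (q , b , q-prime , trans totient≡ (+-identityʳ _))))
... | zero  , 1 , refl , _ , totient≡ = inj₂ (inj₁ (begin
  q * 1 * 1                  ≡⟨ trans (*-identityʳ _) (*-identityʳ q) ⟩
  q                          ≡⟨ suc-pred-prime q-prime ⟨
  suc (q ∸ 1)                ≡⟨ cong suc (trans totient≡ (trans (+-identityʳ _) (+-identityʳ _))) ⟨
  suc (totient (q * 1 * 1))  ∎))
  where open ≡-Reasoning
... | zero  , 2 , refl , _ , totient≡ = inj₂ (inj₂ (inj₁ (begin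
  q * 1 * 2                  ≡⟨ trans (cong (_* 2) (*-identityʳ q)) (*-comm q 2) ⟩
  2 * q                      ≡⟨ cong (2 *_) (suc-pred-prime q-prime) ⟨
  2 * suc (q ∸ 1)            ≡⟨ cong (λ m → 2 * suc m) (trans totient≡ (trans (+-identityʳ _) (+-identityʳ _))) ⟨
  2 * suc (totient (q * 1 * 2))  ∎)))
  where open ≡-Reasoning

A≡4⇒prime-power-form : ∀ {m} → m ≢ 1 → ¬ 4 ∣ m → A≡ m 4 → PrimePowerForm m
A≡4⇒prime-power-form {m} m≢1 4∤m (xs , xs! , xs⇔ , |xs|≡4)
  with sequenceA 0ℓ (Sumₗ.applicative (PrimePowerForm m) 0ℓ) (tabulate classify)
  where
  small : List ℕ
  small = 4 ∷ suc m ∷ 2 * suc m ∷ []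
  classify : ∀ {n} → n ∈ xs → PrimePowerForm m ⊎ n ∈ small
  classify {n} n∈ with totient-preimage n (trans (sym (φ≡totient n)) (Equivalence.to (xs⇔ n) n∈)) m≢1 4∤m
  ... | inj₁ refl               = inj₂ (here refl)
  ... | inj₂ (inj₁ refl)        = inj₂ (there (here refl))
  ... | inj₂ (inj₂ (inj₁ refl)) = inj₂ (there (there (here refl)))
  ... | inj₂ (inj₂ (inj₂ form)) = inj₁ form
... | inj₁ form      = form
... | inj₂ all-small = ⊥-elim (<-irrefl refl (subst (_≤ 3) |xs|≡4
        (length-≤-injection _≡_ xs! (λ {n} n∈ → n , lookup all-small n∈ , refl) (λ e e′ → trans e (sym e′)))))

2*odd≢1 : ∀ j → 2 * (2 * j + 1) ≢ 1
2*odd≢1 j = even≢odd (2 * j + 1) 0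

4∤2*odd : ∀ j → ¬ 4 ∣ 2 * (2 * j + 1)
4∤2*odd j 4∣ with ∣1⇒≡1 (∣m+n∣m⇒∣n (*-cancelˡ-∣ {2} {2 * j + 1} 2 4∣) (m∣m*n j))
... | ()

-- Chebyshev's bound

nCk*k!*[n∸k]!≡n! : ∀ {n k} → k ≤ n → (n C k) * (k ! * (n ∸ k) !) ≡ n !
nCk*k!*[n∸k]!≡n! {n} {k} k≤n = trans (cong (_* (k ! * (n ∸ k) !)) (nCk≡n!/k![n-k]! k≤n))
                                     (m/n*n≡m {{k !* (n ∸ k) !≢0}} (k![n∸k]!∣n! k≤n))

nCk≤2^n : ∀ n k → n C k ≤ 2 ^ n
nCk≤2^n zero    zero    = ≤-refl
nCk≤2^n zero    (suc k) = ≤-trans (≤-reflexive (k>n⇒nCk≡0 {0} {suc k} z<s)) z≤n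
nCk≤2^n (suc n) zero    = m^n>0 2 (suc n)
nCk≤2^n (suc n) (suc k) = begin
  suc n C suc k        ≡⟨ nCk+nC[k+1]≡[n+1]C[k+1] n k ⟨
  n C k + n C suc k    ≤⟨ +-mono-≤ (nCk≤2^n n k) (nCk≤2^n n (suc k)) ⟩
  2 ^ n + 2 ^ n        ≡⟨ cong (2 ^ n +_) (+-identityʳ (2 ^ n)) ⟨
  2 ^ suc n            ∎
  where open ≤-Reasoning

n∣n! : ∀ n .{{_ : NonZero n}} → n ∣ n !
n∣n! (suc n) = m∣m*n (n !)

¬p∣n! : ∀ {p} → Prime p → ∀ n → n < p → ¬ p ∣ n !
¬p∣n! p-prime zero    _    p∣1 = prime≢1 p-prime (∣1⇒≡1 p∣1)
¬p∣n! p-prime (suc n) 1+n<p p∣n! with euclidsLemma (suc n) (n !) p-prime p∣n!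
... | inj₁ p∣1+n = <⇒≱ 1+n<p (∣⇒≤ p∣1+n)
... | inj₂ p∣n!  = ¬p∣n! p-prime n (<-trans (n<1+n n) 1+n<p) p∣n!

central-binomial : ∀ n → ((n + n) C n) * (n ! * n !) ≡ (n + n) !
central-binomial n = subst (λ k → ((n + n) C n) * (n ! * k !) ≡ (n + n) !) (m+n∸m≡n n n)
                           (nCk*k!*[n∸k]!≡n! (m≤m+n n n))

central-binomial≢0 : ∀ n → NonZero ((n + n) C n)
central-binomial≢0 n = ≢-nonZero λ C≡0 →
  ≢-nonZero⁻¹ ((n + n) !) {{(n + n) !≢0}} (trans (sym (central-binomial n)) (cong (_* (n ! * n !)) C≡0))

-- p divides (2n)! = C(2n, n) n! n! but not n!.
prime∣central-binomial : ∀ {p} n → Prime p → n < p → p ≤ n + n → p ∣ (n + n) C n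
prime∣central-binomial {p} n p-prime n<p p≤2n
  with euclidsLemma ((n + n) C n) (n ! * n !) p-prime
         (subst (p ∣_) (sym (central-binomial n)) (∣-trans (n∣n! p {{prime⇒nonZero p-prime}}) (m≤n⇒m!∣n! p≤2n)))
... | inj₁ p∣C    = p∣C
... | inj₂ p∣n!n! with euclidsLemma (n !) (n !) p-prime p∣n!n!
...   | inj₁ p∣n! = ⊥-elim (¬p∣n! p-prime n n<p p∣n!)
...   | inj₂ p∣n! = ⊥-elim (¬p∣n! p-prime n n<p p∣n!)

coprime-*-∣ : ∀ {m n k} → Coprime m n → m ∣ k → n ∣ k → m * n ∣ k
coprime-*-∣ {m} {n} m⊥n m∣k n∣k = subst (_∣ _) lcm≡m*n (lcm-least m∣k n∣k)
  where
  lcm≡m*n : lcm m n ≡ m * n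
  lcm≡m*n = trans (sym (+-identityʳ (lcm m n))) (trans (cong (_* lcm m n) (sym (coprime⇒gcd≡1 m⊥n))) (gcd*lcm m n))

product-distinct-primes-∣ : ∀ {ps N} → Unique ps → All Prime ps → All (_∣ N) ps → product ps ∣ N
product-distinct-primes-∣ {[]}     {N} _          _                 _          = 1∣ N
product-distinct-primes-∣ {p ∷ ps}     (p∉ ∷ ps!) (p-prime ∷ prime) (p∣N ∷ ∣N) =
  coprime-*-∣ (Coprime.sym (coprime-prime p-prime p∤ps)) p∣N (product-distinct-primes-∣ ps! prime ∣N)
  where
  p∤ps : ¬ p ∣ product ps
  p∤ps p∣ps = lookup p∉ (factorisationHasAllPrimeFactors p-prime p∣ps prime) refl

isPrimeᵇ : ℕ → Bool
isPrimeᵇ n = does (prime? n)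

π : ℕ → ℕ
π Y = count isPrimeᵇ (suc Y)

primes-between : ℕ → ℕ
primes-between n = count (λ i → isPrimeᵇ (suc n + i)) n

^length≤product : ∀ {n} ps → All (n <_) ps → n ^ length ps ≤ product ps
^length≤product []       []           = ≤-refl
^length≤product (p ∷ ps) (n<p ∷ n<ps) = *-mono-≤ (<⇒≤ n<p) (^length≤product ps n<ps)

chebyshev-dyadic : ∀ n L → 2 ^ L ≤ n → L * primes-between n ≤ n + n
chebyshev-dyadic n L 2^L≤n = ^-cancelʳ-≤ 2 (s≤s (s≤s z≤n)) (begin
  2 ^ (L * t)        ≡⟨ ^-*-assoc 2 L t ⟨
  (2 ^ L) ^ t        ≤⟨ ^-monoˡ-≤ t 2^L≤n ⟩
  n ^ t              ≡⟨ cong (n ^_) |ps|≡t ⟨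
  n ^ length ps      ≤⟨ ^length≤product ps (tabulate (proj₁ ∘ proj₂ ∘ ∈ps⁻)) ⟩
  product ps         ≤⟨ ∣⇒≤ {{central-binomial≢0 n}} (product-distinct-primes-∣ ps! (tabulate (proj₁ ∘ ∈ps⁻)) (tabulate ps∣C)) ⟩
  (n + n) C n        ≤⟨ nCk≤2^n (n + n) n ⟩
  2 ^ (n + n)        ∎)
  where
  open ≤-Reasoning
  t = primes-between n
  ps : List ℕ
  ps = filter prime? (applyUpTo (suc n +_) n)
  |ps|≡t : length ps ≡ t
  |ps|≡t = length-filter-applyUpTo prime? (suc n +_) n
  ps! : Unique ps
  ps! = filter⁺ prime? (applyUpTo⁺₁ (suc n +_) n (λ i<j _ eq → <⇒≢ i<j (+-cancelˡ-≡ (suc n) _ _ eq)))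
  ∈ps⁻ : ∀ {q} → q ∈ ps → Prime q × n < q × q ≤ n + n
  ∈ps⁻ q∈ with ∈-filter⁻ prime? {xs = applyUpTo (suc n +_) n} q∈
  ... | q∈range , q-prime with ∈-applyUpTo⁻ (suc n +_) q∈range
  ... | i , i<n , refl = q-prime , s≤s (m≤m+n n i) , +-monoʳ-< n i<n
  ps∣C : ∀ {q} → q ∈ ps → q ∣ (n + n) C n
  ps∣C q∈ = let q-prime , n<q , q≤2n = ∈ps⁻ q∈ in prime∣central-binomial n q-prime n<q q≤2n

π-+-≤ : ∀ Y d → π (Y + d) ≤ π Y + d
π-+-≤ Y = count-+-≤ isPrimeᵇ (suc Y)

π-double : ∀ n → π (n + n) ≡ π n + primes-between n
π-double n = ∑-split (suc n) n (𝟙 ∘ isPrimeᵇ)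

-- Dyadic induction: below 2^(L+1) use π Y ≤ Y + 1, above it halve and apply chebyshev-dyadic with 2^L ≤ Y / 2.
π-bound : ∀ L Y → L * π Y ≤ L * 2 ^ suc L + 4 * Y
π-bound L = <-rec _ step
  where
  A = 2 ^ suc L
  step : ∀ Y → (∀ {Y′} → Y′ < Y → L * π Y′ ≤ L * A + 4 * Y′) → L * π Y ≤ L * A + 4 * Y
  step Y rec with Y <? A
  ... | yes Y<A = ≤-trans (*-monoʳ-≤ L (≤-trans (count-≤ isPrimeᵇ (suc Y)) Y<A)) (m≤m+n _ _)
  ... | no  Y≮A = begin
    L * π Y                              ≤⟨ *-monoʳ-≤ L π-Y≤ ⟩
    L * (π n + primes-between n + 1)     ≡⟨ distribute L (π n) (primes-between n) ⟩
    L * π n + L * primes-between n + L   ≤⟨ +-mono-≤ (+-mono-≤ (rec n<Y) (chebyshev-dyadic n L 2^L≤n)) L≤n ⟩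
    L * A + 4 * n + (n + n) + n          ≤⟨ gather (L * A) n ⟩
    L * A + 4 * (n + n)                  ≤⟨ +-monoʳ-≤ (L * A) (*-monoʳ-≤ 4 2n≤Y) ⟩
    L * A + 4 * Y                        ∎
    where
    open ≤-Reasoning
    n = Y / 2
    r = Y % 2
    Y≡ : n + n + r ≡ Y
    Y≡ = sym (trans (m≡m%n+[m/n]*n Y 2) (solve 2 (λ r n → r :+ n :* con 2 := n :+ n :+ r) refl r n))
    2n≤Y : n + n ≤ Y
    2n≤Y = subst (n + n ≤_) Y≡ (m≤m+n (n + n) r)
    2^L≤n : 2 ^ L ≤ n
    2^L≤n = subst (_≤ n) (m*n/n≡m (2 ^ L) 2) (/-monoˡ-≤ 2 (subst (_≤ Y) (*-comm 2 (2 ^ L)) (≮⇒≥ Y≮A)))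
    L≤n : L ≤ n
    L≤n = <⇒≤ (<-≤-trans (n<2^n L) 2^L≤n)
    n<Y : n < Y
    n<Y = <-≤-trans (m<m+n n (<-≤-trans (m^n>0 2 L) 2^L≤n)) 2n≤Y
    π-Y≤ : π Y ≤ π n + primes-between n + 1
    π-Y≤ = begin
      π Y               ≡⟨ cong π Y≡ ⟨
      π (n + n + r)     ≤⟨ π-+-≤ (n + n) r ⟩
      π (n + n) + r     ≤⟨ +-mono-≤ (≤-reflexive (π-double n)) (s≤s⁻¹ (m%n<n Y 2)) ⟩
      π n + primes-between n + 1 ∎
    distribute : ∀ L a b → L * (a + b + 1) ≡ L * a + L * b + L
    distribute = solve 3 (λ L a b → L :* (a :+ b :+ con 1) := L :* a :+ L :* b :+ L) refl
    gather : ∀ x n → x + 4 * n + (n + n) + n ≤ x + 4 * (n + n)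
    gather x n = subst (x + 4 * n + (n + n) + n ≤_)
      (solve 2 (λ x n → x :+ con 4 :* n :+ (n :+ n) :+ n :+ n := x :+ con 4 :* (n :+ n)) refl x n) (m≤m+n _ n)

-- Counting 𝒱¹₄(x)

*pred<square⇒≤ : ∀ n s → n * (n ∸ 1) < suc s * suc s → n ≤ suc s
*pred<square⇒≤ n s n[n-1]<[1+s]² = ≮⇒≥ λ 1+s<n →
  <⇒≱ n[n-1]<[1+s]² (*-mono-≤ (<⇒≤ 1+s<n) (∸-monoˡ-≤ 1 1+s<n))

-- 216 K³ t³ ≤ 432 K³ x < 432 K³ (s + 1)² ≤ (s + 1)³, so 6 K t ≤ s.
cube-bound : ∀ K t x s → t * t * t ≤ 2 * x → x < suc s * suc s → 432 * (K * K * K) ≤ s → t * (6 * K) ≤ s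
cube-bound K t x s t³≤2x x<S² 432K³≤s = ≮⇒≥ λ s<6Kt → <-irrefl refl (begin-strict
  S * S * S                             ≤⟨ *-mono-≤ (*-mono-≤ s<6Kt s<6Kt) s<6Kt ⟩
  t * (6 * K) * (t * (6 * K)) * (t * (6 * K))  ≡⟨ cube-expand t K ⟩
  216 * (K * K * K) * (t * t * t)       ≤⟨ *-monoʳ-≤ (216 * (K * K * K)) t³≤2x ⟩
  216 * (K * K * K) * (2 * x)           ≡⟨ double K x ⟩
  432 * (K * K * K) * x                 ≤⟨ *-monoʳ-≤ (432 * (K * K * K)) (<⇒≤ x<S²) ⟩
  432 * (K * K * K) * (S * S)           <⟨ *-monoˡ-< (S * S) (s≤s 432K³≤s) ⟩
  S * (S * S)                           ≡⟨ *-assoc S S S ⟨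
  S * S * S                             ∎)
  where
  open ≤-Reasoning
  S = suc s
  cube-expand : ∀ t K → t * (6 * K) * (t * (6 * K)) * (t * (6 * K)) ≡ 216 * (K * K * K) * (t * t * t)
  cube-expand = solve 2 (λ t K → t :* (con 6 :* K) :* (t :* (con 6 :* K)) :* (t :* (con 6 :* K))
                               := con 216 :* (K :* K :* K) :* (t :* t :* t)) refl
  double : ∀ K x → 216 * (K * K * K) * (2 * x) ≡ 432 * (K * K * K) * x
  double = solve 2 (λ K x → con 216 :* (K :* K :* K) :* (con 2 :* x) := con 432 :* (K :* K :* K) :* x) refl

-- p ≤ 2 (p - 1) absorbs the factor p - 1, and 3 (w + 1) ≤ r + 3 w + 3.
prime-power-cube-≤ : ∀ {p} → 1 < p → ∀ w r →
  p ^ suc w * p ^ suc w * p ^ suc w ≤ 2 * (p ^ suc (suc (r + 3 * w)) * (p ∸ 1))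
prime-power-cube-≤ {p} 1<p w r = begin
  t * t * t                    ≡⟨ trans (^-distribˡ-+-* p (suc w + suc w) (suc w)) (cong (_* t) (^-distribˡ-+-* p (suc w) (suc w))) ⟨
  p ^ (suc w + suc w + suc w)  ≤⟨ ^-monoʳ-≤ p {{>-nonZero (<-trans z<s 1<p)}} exponents ⟩
  p ^ suc E                    ≡⟨ *-comm p (p ^ E) ⟩
  p ^ E * p                    ≤⟨ *-monoʳ-≤ (p ^ E) (≤2*pred 1<p) ⟩
  p ^ E * (2 * (p ∸ 1))        ≡⟨ solve 2 (λ a b → a :* (con 2 :* b) := con 2 :* (a :* b)) refl (p ^ E) (p ∸ 1) ⟩
  2 * (p ^ E * (p ∸ 1))        ∎
  where
  open ≤-Reasoning
  t = p ^ suc w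
  E = suc (suc (r + 3 * w))
  exponents : suc w + suc w + suc w ≤ suc E
  exponents = subst (suc w + suc w + suc w ≤_)
    (solve 2 (λ w r → (con 1 :+ w) :+ (con 1 :+ w) :+ (con 1 :+ w) :+ r := con 3 :+ (r :+ con 3 :* w)) refl w r)
    (m≤m+n _ r)

-- Even codes 2p record m = p (p - 1); odd codes 2 (3 p^(w+1) + r) + 1 record m = p^(r + 3w + 2) (p - 1).
Code : ℕ → ℕ → Set
Code m c = (∃ λ p → Prime p × c ≡ 2 * p × m ≡ p ^ 1 * (p ∸ 1))
         ⊎ (∃ λ p → ∃₂ λ w r → Prime p × r < 3 × c ≡ suc (2 * (3 * p ^ suc w + r)) × m ≡ p ^ suc (suc (r + 3 * w)) * (p ∸ 1))

Code-injective : ∀ {m m′ c} → Code m c → Code m′ c → m ≡ m′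
Code-injective (inj₁ (p , _ , refl , refl)) (inj₁ (p′ , _ , c≡ , refl)) with *-cancelˡ-≡ p p′ 2 c≡
... | refl = refl
Code-injective (inj₁ (p , _ , refl , _)) (inj₂ (p′ , w , r , _ , _ , c≡ , _)) = ⊥-elim (even≢odd p (3 * p′ ^ suc w + r) c≡)
Code-injective (inj₂ (p , w , r , _ , _ , refl , _)) (inj₁ (p′ , _ , c≡ , _)) = ⊥-elim (even≢odd p′ (3 * p ^ suc w + r) (sym c≡))
Code-injective (inj₂ (p , w , r , p-prime , r<3 , refl , refl)) (inj₂ (p′ , w′ , r′ , p′-prime , r′<3 , c≡ , refl))
  with divMod-injective 3 r<3 r′<3 (*-cancelˡ-≡ (3 * p ^ suc w + r) (3 * p′ ^ suc w′ + r′) 2 (suc-injective c≡))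
... | t≡t′ , refl with prime-power-injective p-prime p′-prime w w′ t≡t′
... | refl , refl = refl

module _ (k x s : ℕ) (x<[1+s]² : x < suc s * suc s) (s-large : 432 * (suc k * suc k * suc k) ≤ s) where

  private
    K = suc k
    D = s / (6 * K)

  codes : List ℕ
  codes = map (2 *_) (support isPrimeᵇ (suc (suc s))) ++ map (λ v → suc (2 * v)) (upTo (3 * suc D))

  length-codes : length codes ≡ π (suc s) + 3 * suc D
  length-codes = begin
    length codes
      ≡⟨ length-++ (map (2 *_) (support isPrimeᵇ (suc (suc s)))) {map (λ v → suc (2 * v)) (upTo (3 * suc D))} ⟩
    length (map (2 *_) (support isPrimeᵇ (suc (suc s)))) + length (map (λ v → suc (2 * v)) (upTo (3 * suc D)))
      ≡⟨ cong₂ _+_ (trans (length-map (2 *_) (support isPrimeᵇ (suc (suc s)))) (length-support isPrimeᵇ (suc (suc s))))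
                   (trans (length-map (λ v → suc (2 * v)) (upTo (3 * suc D))) (length-upTo (3 * suc D))) ⟩
    π (suc s) + 3 * suc D ∎
    where open ≡-Reasoning

  encode : ∀ {m} → m ≤ x → PrimePowerForm m → ∃ λ c → c ∈ codes × Code m c
  encode m≤x (p , zero , p-prime , refl) =
    2 * p , ∈-++⁺ˡ {ys = map (λ v → suc (2 * v)) (upTo (3 * suc D))} (∈-map⁺ (2 *_) (∈-support⁺ {isPrimeᵇ} (s≤s p≤1+s) (subst T (sym (dec-true (prime? p) p-prime)) tt))) ,
    inj₁ (p , p-prime , refl , refl)
    where
    p≤1+s : p ≤ suc s
    p≤1+s = *pred<square⇒≤ p s (≤-<-trans (subst (λ q → q * (p ∸ 1) ≤ x) (*-identityʳ p) m≤x) x<[1+s]²)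
  encode m≤x (p , suc b , p-prime , refl) =
    suc (2 * (3 * t + r)) , ∈-++⁺ʳ (map (2 *_) (support isPrimeᵇ (suc (suc s)))) (∈-map⁺ (λ v → suc (2 * v)) (∈-upTo⁺ v<)) ,
    inj₂ (p , w , r , p-prime , r<3 , refl , cong (λ e → p ^ suc (suc e) * (p ∸ 1)) b≡)
    where
    w = b / 3
    r = b % 3
    r<3 = m%n<n b 3
    b≡ : b ≡ r + 3 * w
    b≡ = trans (m≡m%n+[m/n]*n b 3) (cong (r +_) (*-comm w 3))
    t = p ^ suc w
    t≤D : t ≤ D
    t≤D = subst (_≤ D) (m*n/n≡m t (6 * K)) (/-monoˡ-≤ (6 * K)
      (cube-bound K t x s (≤-trans (prime-power-cube-≤ (prime>1 p-prime) w r)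
                                   (*-monoʳ-≤ 2 (subst (λ e → p ^ suc (suc e) * (p ∸ 1) ≤ x) b≡ m≤x)))
                  x<[1+s]² s-large))
    v< : 3 * t + r < 3 * suc D
    v< = begin-strict
      3 * t + r   <⟨ +-monoʳ-< (3 * t) r<3 ⟩
      3 * t + 3   ≡⟨ trans (*-suc 3 t) (+-comm 3 (3 * t)) ⟨
      3 * suc t   ≤⟨ *-monoʳ-≤ 3 (s≤s t≤D) ⟩
      3 * suc D   ∎
      where open ≤-Reasoning

  V¹₄≤-card-≤ : ∀ {c} → HasCard (V¹₄≤ x) c → c ≤ π (suc s) + 3 * suc D
  V¹₄≤-card-≤ (ms , ms! , ms⇔ , refl) = subst (length ms ≤_) length-codes (length-≤-injection Code ms! encode′ Code-injective)
    where
    encode′ : ∀ {m} → m ∈ ms → ∃ λ c → c ∈ codes × Code m c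
    encode′ {m} m∈ with Equivalence.to (ms⇔ m) m∈
    ... | m≤x , (j , refl) , A≡4 = encode m≤x (A≡4⇒prime-power-form (2*odd≢1 j) (4∤2*odd j) A≡4)

threshold : ℕ → ℕ
threshold k = 4 * K * 2 ^ suc (16 * K) + 12 * K + 1 + 432 * (K * K * K)
  where K = suc k

-- With L = 16K, π-bound gives 4K π(s + 1) ≤ 4K 2^(16K+1) + s + 1, and 4K · 3 (s/6K + 1) ≤ 2s + 12K.
scaled-count-≤ : ∀ k s {c} → threshold k ≤ s → c ≤ π (suc s) + 3 * suc (s / (6 * suc k)) → suc k * c ≤ s
scaled-count-≤ k s {c} large c≤ = *-cancelˡ-≤ 4 (begin
  4 * (K * c)                               ≤⟨ *-monoʳ-≤ 4 (*-monoʳ-≤ K c≤) ⟩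
  4 * (K * (P + 3 * suc D))                 ≡⟨ expand K P D ⟩
  4 * K * P + 2 * (D * (6 * K)) + 12 * K    ≤⟨ +-monoˡ-≤ (12 * K) (+-mono-≤ 4KP≤ (*-monoʳ-≤ 2 (m/n*n≤m s (6 * K)))) ⟩
  4 * K * A + suc s + 2 * s + 12 * K        ≡⟨ regroup (4 * K * A) K s ⟩
  3 * s + (4 * K * A + 12 * K + 1)          ≤⟨ +-monoʳ-≤ (3 * s) (≤-trans (m≤m+n _ _) large) ⟩
  3 * s + s                                 ≡⟨ solve 1 (λ s → con 3 :* s :+ s := con 4 :* s) refl s ⟩
  4 * s                                     ∎)
  where
  open ≤-Reasoning
  K = suc k
  A = 2 ^ suc (16 * K)
  P = π (suc s)
  D = s / (6 * K)
  4KP≤ : 4 * K * P ≤ 4 * K * A + suc s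
  4KP≤ = *-cancelˡ-≤ 4 (subst₂ _≤_
    (solve 2 (λ K P → con 16 :* K :* P := con 4 :* (con 4 :* K :* P)) refl K P)
    (solve 3 (λ K A s → con 16 :* K :* A :+ con 4 :* (con 1 :+ s) := con 4 :* (con 4 :* K :* A :+ (con 1 :+ s))) refl K A s)
    (π-bound (16 * K) (suc s)))
  expand : ∀ K P D → 4 * (K * (P + 3 * suc D)) ≡ 4 * K * P + 2 * (D * (6 * K)) + 12 * K
  expand = solve 3 (λ K P D → con 4 :* (K :* (P :+ con 3 :* (con 1 :+ D)))
                            := con 4 :* K :* P :+ con 2 :* (D :* (con 6 :* K)) :+ con 12 :* K) refl
  regroup : ∀ X K s → X + suc s + 2 * s + 12 * K ≡ 3 * s + (X + 12 * K + 1)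
  regroup = solve 3 (λ X K s → X :+ (con 1 :+ s) :+ con 2 :* s :+ con 12 :* K
                             := con 3 :* s :+ (X :+ con 12 :* K :+ con 1)) refl

corollary2p3 : (k : ℕ) → Σ ℕ λ N → (x : ℕ) → N ≤ x →
    (c : ℕ) → HasCard (V¹₄≤ x) c → (suc k * c) ^ 2 ≤ x
corollary2p3 k = threshold k * threshold k , bound
  where
  bound : ∀ x → threshold k * threshold k ≤ x → ∀ c → HasCard (V¹₄≤ x) c → (suc k * c) ^ 2 ≤ x
  bound x T²≤x c card with isqrt x
  ... | s , s²≤x , x<[1+s]² = begin
    (suc k * c) ^ 2   ≤⟨ ^-monoˡ-≤ 2 Kc≤s ⟩
    s ^ 2             ≡⟨ cong (s *_) (*-identityʳ s) ⟩
    s * s             ≤⟨ s²≤x ⟩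
    x                 ∎
    where
    open ≤-Reasoning
    T≤s : threshold k ≤ s
    T≤s = square<⇒≤ s T²≤x x<[1+s]²
    Kc≤s : suc k * c ≤ s
    Kc≤s = scaled-count-≤ k s T≤s (V¹₄≤-card-≤ k x s x<[1+s]² (≤-trans (m≤n+m _ _) T≤s) card)
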